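{- Let $\alpha,n\in\mathbb{N}$ with $\alpha\geq 2$ and $n\geq 2\alpha+3+(\alpha \bmod 2)$, and let $k$ be a positive integer. Then: (1) if $\frac{2}{\alpha}k+4\leq n<\frac{2}{\alpha-1}k+3$, then $\gamma_{\times k}(K(n,2))\geq k+2\alpha$; (2) if $n=\left\lceil\frac{2}{\alpha}k\right\rceil+3$, then $\gamma_{\times k}(K(n,2))\geq k+2\alpha+1$.
   Context: The Kneser graph $K(n,2)$ has as vertices the $2$-subsets of $[n]=\{1,\dots,n\}$, two vertices adjacent iff disjoint. For a vertex $v$, $N[v]$ is its closed neighbourhood. A set $D$ of vertices is a $k$-tuple dominating set if $|N[v]\cap D|\geq k$ for every vertex $v$; $\gamma_{\times k}(K(n,2))$ is the minimum cardinality of such a set. -}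

module Defs where

open import Data.Nat using (ℕ; zero; suc; _+_; _*_; _∸_; _≤_; _<_; NonZero)
open import Data.Nat.DivMod using (_/_)
open import Data.Fin using (Fin; _<_)
open import Data.Fin.Properties using (_≟_)
open import Data.Bool using (Bool; _∧_; _∨_; not)
open import Data.Product using (Σ; _×_; _,_; proj₁; proj₂)
open import Data.List using (List; length; filterᵇ)
open import Data.List.Relation.Unary.Unique.Propositional using (Unique)
open import Relation.Nullary.Decidable using (⌊_⌋)

-- Vertices of the Kneser graph K(n,2): 2-subsets {i,j} of [n] = Fin n,
-- represented canonically as ordered pairs (i , j) with i < j.
KVertex : ℕ → Set
KVertex n = Σ (Fin n × Fin n) (λ p → proj₁ p Data.Fin.< proj₂ p)

fst snd : ∀ {n} → KVertex n → Fin n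
fst v = proj₁ (proj₁ v)
snd v = proj₂ (proj₁ v)

_∈ᵥ_ : ∀ {n} → Fin n → KVertex n → Bool
a ∈ᵥ v = ⌊ a ≟ fst v ⌋ ∨ ⌊ a ≟ snd v ⌋

sameVertex : ∀ {n} → KVertex n → KVertex n → Bool
sameVertex u v = ⌊ fst u ≟ fst v ⌋ ∧ ⌊ snd u ≟ snd v ⌋

disjoint : ∀ {n} → KVertex n → KVertex n → Bool
disjoint u v = not (fst u ∈ᵥ v) ∧ not (snd u ∈ᵥ v)

inClosedNbhd : ∀ {n} → KVertex n → KVertex n → Bool
inClosedNbhd v u = sameVertex u v ∨ disjoint u v

closedNbhdCount : ∀ {n} → List (KVertex n) → KVertex n → ℕ
closedNbhdCount D v = length (filterᵇ (inClosedNbhd v) D)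

IsKTupleDominating : (n k : ℕ) → List (KVertex n) → Set
IsKTupleDominating n k D = Unique D × (∀ (v : KVertex n) → k ≤ closedNbhdCount D v)

γ×≥ : (k n m : ℕ) → Set
γ×≥ k n m = ∀ (D : List (KVertex n)) → IsKTupleDominating n k D → m ≤ length D

-- ceiling division ⌈a / b⌉ (only meaningful for b ≥ 1; set to 0 for b = 0)
⌈_/_⌉ : ℕ → ℕ → ℕ
⌈ a / zero ⌉ = 0
⌈ a / suc b ⌉ = (a + b) / suc b

-- Read a k-tuple dominating set D of size m = k + T as a multigraph on [n]. For v = {a,b}, the
-- closed neighbourhood of v meets D in m − deg a − deg b + 2·mult(ab) edges, so domination gives
-- k + deg a + deg b ≤ m + 2·mult(ab) for all a ≠ b. Fixing a point u of maximum degree Δ and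
-- summing over the other points, the handshake identity turns this into linear inequalities in
-- n, k, T and Δ, which are sharper when 2Δ = T + 1 because then every point not joined to u has
-- degree < Δ. Comparing 2Δ with T + 1 leaves three regimes; in each, T ≤ 2α − 1 (resp. T ≤ 2α)
-- contradicts the hypotheses on n and k, except that in case (2) with 2Δ > T + 1 one is forced
-- to n = 2α + 3 and 2k = (2α − 1)α + 1: the term α mod 2 rules out odd α, and for even α the
-- right-hand side is odd.

{-# OPTIONS --safe #-}
module Submission where

open import Data.Bool using (Bool; true; false; _∧_; _∨_; not; T?)
open import Data.Bool.Properties using (∧-idem; ∧-comm)
open import Data.Empty using (⊥)
open import Data.Fin as Fin using (Fin; zero; suc; punchIn)
open import Data.Fin.Properties using (_≟_; <⇒≢; <-asym; punchInᵢ≢i)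
open import Data.List using (List; []; _∷_; length; filterᵇ; lookup; allFin)
open import Data.List.Extrema.Nat using (argmax; f[xs]≤f[argmax])
open import Data.List.Membership.Propositional.Properties using (∈-allFin)
open import Data.List.Properties using (length-filter)
import Data.List.Relation.Unary.All as All
open import Data.Nat using (ℕ; zero; suc; _+_; _*_; _∸_; _≤_; _<_; z≤n; s≤s; _%_; _/_)
open import Data.Nat.DivMod using (m≡m%n+[m/n]*n; m/n*n≤m)
open import Data.Nat.Properties
  using ( +-*-semiring; +-commutativeSemigroup; +-comm; +-assoc; +-identityʳ; +-suc; *-comm; *-suc
        ; *-identityʳ; *-distribˡ-+; +-mono-≤; +-monoˡ-≤; +-monoʳ-≤; *-monoʳ-≤; +-cancelˡ-≤; +-cancelʳ-≤
        ; +-cancelˡ-≡; +-cancelʳ-≡; *-cancelˡ-≤; *-cancelˡ-<; suc-injective; ≤-trans; ≤-reflexive; ≤-antisym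
        ; ≤-pred; <-cmp; ≮⇒≥; <⇒≱; n≤0⇒n≡0; m≤m+n; m≤n+m; m+[n∸m]≡n; even≢odd; module ≤-Reasoning )
open import Data.Nat.Tactic.RingSolver using (solve-∀)
open import Algebra.Properties.CommutativeSemigroup +-commutativeSemigroup using (xy∙z≈xz∙y)
open import Algebra.Properties.Semiring.Sum +-*-semiring
  using (sum-syntax; sum-cong-≗; sum-remove; sum-replicate-zero; ∑-distrib-+; ∑-comm; *-distribˡ-sum)
open import Data.Product using (_×_; _,_; ∃-syntax)
open import Function using (_∘_)
open import Relation.Binary using (Tri; tri<; tri≈; tri>)
open import Relation.Binary.PropositionalEquality
  using (_≡_; _≢_; refl; sym; trans; cong; cong₂; subst; subst₂; ≡-≟-identity; ≢-≟-identity; module ≡-Reasoning)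
open import Relation.Nullary using (yes; no; contradiction)
open import Relation.Nullary.Decidable using (⌊_⌋)

open import Defs

𝟙 : Bool → ℕ
𝟙 true  = 1
𝟙 false = 0

𝟙-∧ : ∀ p q → 𝟙 (p ∧ q) ≡ 𝟙 p * 𝟙 q
𝟙-∧ true  q = sym (+-identityʳ (𝟙 q))
𝟙-∧ false q = refl

𝟙-∨ : ∀ p q → p ∧ q ≡ false → 𝟙 (p ∨ q) ≡ 𝟙 p + 𝟙 q
𝟙-∨ true  false _ = refl
𝟙-∨ false q     _ = refl

∑-const : ∀ n c → ∑[ i < n ] c ≡ n * c
∑-const zero    c = refl
∑-const (suc n) c = cong (c +_) (∑-const n c)

∑-+-const : ∀ {n} (f : Fin n → ℕ) c → ∑[ i < n ] (f i + c) ≡ ∑[ i < n ] f i + n * c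
∑-+-const {n} f c = trans (∑-distrib-+ f (λ _ → c)) (cong (_ +_) (∑-const n c))

∑-const-+ : ∀ {n} c (f : Fin n → ℕ) → ∑[ i < n ] (c + f i) ≡ n * c + ∑[ i < n ] f i
∑-const-+ {n} c f = trans (∑-distrib-+ (λ _ → c) f) (cong (_+ _) (∑-const n c))

∑-mono-≤ : ∀ {n} {f g : Fin n → ℕ} → (∀ i → f i ≤ g i) → ∑[ i < n ] f i ≤ ∑[ i < n ] g i
∑-mono-≤ {zero}  f≤g = z≤n
∑-mono-≤ {suc n} f≤g = +-mono-≤ (f≤g zero) (∑-mono-≤ (f≤g ∘ suc))

length-filterᵇ : ∀ {A : Set} (p : A → Bool) (xs : List A) →
  length (filterᵇ p xs) ≡ ∑[ i < length xs ] 𝟙 (p (lookup xs i))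
length-filterᵇ p []       = refl
length-filterᵇ p (x ∷ xs) with p x
... | true  = cong suc (length-filterᵇ p xs)
... | false = length-filterᵇ p xs

⌊≟⌋-refl : ∀ {n} (x : Fin n) → ⌊ x ≟ x ⌋ ≡ true
⌊≟⌋-refl x = cong ⌊_⌋ (≡-≟-identity _≟_ refl)

⌊≟⌋-≢ : ∀ {n} {x y : Fin n} → x ≢ y → ⌊ x ≟ y ⌋ ≡ false
⌊≟⌋-≢ x≢y = cong ⌊_⌋ (≢-≟-identity _≟_ x≢y)

⌊≟⌋-comm : ∀ {n} (x y : Fin n) → ⌊ x ≟ y ⌋ ≡ ⌊ y ≟ x ⌋
⌊≟⌋-comm x y with x ≟ y
... | yes refl = sym (⌊≟⌋-refl x)
... | no x≢y   = sym (⌊≟⌋-≢ (x≢y ∘ sym))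

⌊≟⌋-∧-≢ : ∀ {n} (x : Fin n) {y z} → y ≢ z → ⌊ x ≟ y ⌋ ∧ ⌊ x ≟ z ⌋ ≡ false
⌊≟⌋-∧-≢ x {y} y≢z with x ≟ y
... | yes refl = ⌊≟⌋-≢ y≢z
... | no _     = refl

⌊≟⌋-∧-≢ˡ : ∀ {n} {x y} (z : Fin n) → x ≢ y → ⌊ x ≟ z ⌋ ∧ ⌊ y ≟ z ⌋ ≡ false
⌊≟⌋-∧-≢ˡ {x = x} z x≢y with x ≟ z
... | yes refl = ⌊≟⌋-≢ (x≢y ∘ sym)
... | no _     = refl

∑-𝟙-≟ : ∀ {n} (x : Fin n) → ∑[ a < n ] 𝟙 ⌊ a ≟ x ⌋ ≡ 1
∑-𝟙-≟ {suc n} x = begin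
  ∑[ a < suc n ] 𝟙 ⌊ a ≟ x ⌋
    ≡⟨ sum-remove {i = x} (λ a → 𝟙 ⌊ a ≟ x ⌋) ⟩
  𝟙 ⌊ x ≟ x ⌋ + ∑[ j < n ] 𝟙 ⌊ punchIn x j ≟ x ⌋
    ≡⟨ cong₂ _+_ (cong 𝟙 (⌊≟⌋-refl x)) (sum-cong-≗ (cong 𝟙 ∘ ⌊≟⌋-≢ ∘ punchInᵢ≢i x)) ⟩
  1 + ∑[ j < n ] 0
    ≡⟨ cong suc (sum-replicate-zero n) ⟩
  1 ∎
  where open ≡-Reasoning

-- xa stands for ⌊ x ≟ a ⌋ etc., for e = {x,y} and v = {a,b}; the hypotheses say x ≢ y, a ≢ b,
-- and that x ≡ b, y ≡ a cannot both hold, as both pairs are increasing.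
closedNbhd-table : ∀ xa xb ya yb →
  xa ∧ xb ≡ false → ya ∧ yb ≡ false → xa ∧ ya ≡ false → xb ∧ yb ≡ false → xb ∧ ya ≡ false →
  𝟙 ((xa ∧ yb) ∨ (not (xa ∨ xb) ∧ not (ya ∨ yb))) + 𝟙 (xa ∨ ya) + 𝟙 (xb ∨ yb)
    ≡ 1 + 2 * 𝟙 ((xa ∨ ya) ∧ (xb ∨ yb))
closedNbhd-table true  true  _     _     () _  _  _  _
closedNbhd-table true  false true  _     _  _  () _  _
closedNbhd-table true  false false true  _  _  _  _  _  = refl
closedNbhd-table true  false false false _  _  _  _  _  = refl
closedNbhd-table false true  true  _     _  _  _  _  ()
closedNbhd-table false true  false true  _  _  _  () _
closedNbhd-table false true  false false _  _  _  _  _  = refl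
closedNbhd-table false false true  true  _  () _  _  _
closedNbhd-table false false true  false _  _  _  _  _  = refl
closedNbhd-table false false false true  _  _  _  _  _  = refl
closedNbhd-table false false false false _  _  _  _  _  = refl

closedNbhd-incidence : ∀ {N} {a b : Fin N} (a<b : a Fin.< b) (e : KVertex N) →
  𝟙 (inClosedNbhd ((a , b) , a<b) e) + 𝟙 (a ∈ᵥ e) + 𝟙 (b ∈ᵥ e) ≡ 1 + 2 * 𝟙 (a ∈ᵥ e ∧ b ∈ᵥ e)
closedNbhd-incidence {a = a} {b} a<b ((x , y) , x<y)
  rewrite ⌊≟⌋-comm a x | ⌊≟⌋-comm a y | ⌊≟⌋-comm b x | ⌊≟⌋-comm b y =
  closedNbhd-table ⌊ x ≟ a ⌋ ⌊ x ≟ b ⌋ ⌊ y ≟ a ⌋ ⌊ y ≟ b ⌋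
    (⌊≟⌋-∧-≢ x a≢b) (⌊≟⌋-∧-≢ y a≢b) (⌊≟⌋-∧-≢ˡ a x≢y) (⌊≟⌋-∧-≢ˡ b x≢y) crossed
  where
  a≢b = <⇒≢ a<b
  x≢y = <⇒≢ x<y
  crossed : ⌊ x ≟ b ⌋ ∧ ⌊ y ≟ a ⌋ ≡ false
  crossed with x ≟ b | y ≟ a
  ... | yes refl | yes refl = contradiction x<y (<-asym a<b)
  ... | yes _    | no _     = refl
  ... | no _     | _        = refl

∑-∈ᵥ : ∀ {N} (e : KVertex N) → ∑[ a < N ] 𝟙 (a ∈ᵥ e) ≡ 2
∑-∈ᵥ {N} ((x , y) , x<y) = begin
  ∑[ a < N ] 𝟙 (⌊ a ≟ x ⌋ ∨ ⌊ a ≟ y ⌋)               ≡⟨ sum-cong-≗ (λ a → 𝟙-∨ ⌊ a ≟ x ⌋ _ (⌊≟⌋-∧-≢ a (<⇒≢ x<y))) ⟩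
  ∑[ a < N ] (𝟙 ⌊ a ≟ x ⌋ + 𝟙 ⌊ a ≟ y ⌋)             ≡⟨ ∑-distrib-+ (λ a → 𝟙 ⌊ a ≟ x ⌋) (λ a → 𝟙 ⌊ a ≟ y ⌋) ⟩
  ∑[ a < N ] 𝟙 ⌊ a ≟ x ⌋ + ∑[ a < N ] 𝟙 ⌊ a ≟ y ⌋   ≡⟨ cong₂ _+_ (∑-𝟙-≟ x) (∑-𝟙-≟ y) ⟩
  2                                                  ∎
  where open ≡-Reasoning

module _ {N : ℕ} (D : List (KVertex N)) where

  degree : Fin N → ℕ
  degree a = ∑[ i < length D ] 𝟙 (a ∈ᵥ lookup D i)

  codegree : Fin N → Fin N → ℕ
  codegree a b = ∑[ i < length D ] 𝟙 (a ∈ᵥ lookup D i ∧ b ∈ᵥ lookup D i)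

  ∑-degree : ∑[ a < N ] degree a ≡ 2 * length D
  ∑-degree = begin
    ∑[ a < N ] ∑[ i < length D ] 𝟙 (a ∈ᵥ lookup D i)  ≡⟨ ∑-comm (λ a i → 𝟙 (a ∈ᵥ lookup D i)) ⟩
    ∑[ i < length D ] ∑[ a < N ] 𝟙 (a ∈ᵥ lookup D i)  ≡⟨ sum-cong-≗ (∑-∈ᵥ ∘ lookup D) ⟩
    ∑[ i < length D ] 2                                ≡⟨ ∑-const (length D) 2 ⟩
    length D * 2                                       ≡⟨ *-comm (length D) 2 ⟩
    2 * length D                                       ∎
    where open ≡-Reasoning

  ∑-codegree : ∀ u → ∑[ w < N ] codegree u w ≡ 2 * degree u
  ∑-codegree u = begin
    ∑[ w < N ] ∑[ i < length D ] 𝟙 (u ∈ᵥ lookup D i ∧ w ∈ᵥ lookup D i)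
      ≡⟨ ∑-comm (λ w i → 𝟙 (u ∈ᵥ lookup D i ∧ w ∈ᵥ lookup D i)) ⟩
    ∑[ i < length D ] ∑[ w < N ] 𝟙 (u ∈ᵥ lookup D i ∧ w ∈ᵥ lookup D i)
      ≡⟨ sum-cong-≗ (λ i → ∑-incident (lookup D i)) ⟩
    ∑[ i < length D ] (2 * 𝟙 (u ∈ᵥ lookup D i))
      ≡⟨ *-distribˡ-sum 2 (λ i → 𝟙 (u ∈ᵥ lookup D i)) ⟨
    2 * degree u
      ∎
    where
    open ≡-Reasoning
    ∑-incident : ∀ e → ∑[ w < N ] 𝟙 (u ∈ᵥ e ∧ w ∈ᵥ e) ≡ 2 * 𝟙 (u ∈ᵥ e)
    ∑-incident e = begin
      ∑[ w < N ] 𝟙 (u ∈ᵥ e ∧ w ∈ᵥ e)     ≡⟨ sum-cong-≗ (λ w → 𝟙-∧ (u ∈ᵥ e) (w ∈ᵥ e)) ⟩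
      ∑[ w < N ] (𝟙 (u ∈ᵥ e) * 𝟙 (w ∈ᵥ e)) ≡⟨ *-distribˡ-sum (𝟙 (u ∈ᵥ e)) (λ w → 𝟙 (w ∈ᵥ e)) ⟨
      𝟙 (u ∈ᵥ e) * ∑[ w < N ] 𝟙 (w ∈ᵥ e)   ≡⟨ cong (𝟙 (u ∈ᵥ e) *_) (∑-∈ᵥ e) ⟩
      𝟙 (u ∈ᵥ e) * 2                       ≡⟨ *-comm (𝟙 (u ∈ᵥ e)) 2 ⟩
      2 * 𝟙 (u ∈ᵥ e)                       ∎

  codegree-diag : ∀ u → codegree u u ≡ degree u
  codegree-diag u = sum-cong-≗ (λ i → cong 𝟙 (∧-idem (u ∈ᵥ lookup D i)))

  codegree-comm : ∀ u w → codegree u w ≡ codegree w u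
  codegree-comm u w = sum-cong-≗ (λ i → cong 𝟙 (∧-comm (u ∈ᵥ lookup D i) (w ∈ᵥ lookup D i)))

  closedNbhdCount-degree : ∀ {a b} (a<b : a Fin.< b) →
    closedNbhdCount D ((a , b) , a<b) + degree a + degree b ≡ length D + 2 * codegree a b
  closedNbhdCount-degree {a} {b} a<b = begin
    closedNbhdCount D v + degree a + degree b
      ≡⟨ cong (λ c → c + degree a + degree b) (length-filterᵇ (inClosedNbhd v) D) ⟩
    ∑[ i < length D ] 𝟙 (inClosedNbhd v (lookup D i)) + degree a + degree b
      ≡⟨ cong (_+ degree b) (∑-distrib-+ (λ i → 𝟙 (inClosedNbhd v (lookup D i))) _) ⟨
    ∑[ i < length D ] (𝟙 (inClosedNbhd v (lookup D i)) + 𝟙 (a ∈ᵥ lookup D i)) + degree b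
      ≡⟨ ∑-distrib-+ (λ i → 𝟙 (inClosedNbhd v (lookup D i)) + 𝟙 (a ∈ᵥ lookup D i)) _ ⟨
    ∑[ i < length D ] (𝟙 (inClosedNbhd v (lookup D i)) + 𝟙 (a ∈ᵥ lookup D i) + 𝟙 (b ∈ᵥ lookup D i))
      ≡⟨ sum-cong-≗ (closedNbhd-incidence a<b ∘ lookup D) ⟩
    ∑[ i < length D ] (1 + 2 * 𝟙 (a ∈ᵥ lookup D i ∧ b ∈ᵥ lookup D i))
      ≡⟨ ∑-distrib-+ (λ _ → 1) (λ i → 2 * 𝟙 (a ∈ᵥ lookup D i ∧ b ∈ᵥ lookup D i)) ⟩
    ∑[ i < length D ] 1 + ∑[ i < length D ] (2 * 𝟙 (a ∈ᵥ lookup D i ∧ b ∈ᵥ lookup D i))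
      ≡⟨ cong₂ _+_ (trans (∑-const (length D) 1) (*-identityʳ (length D)))
                   (sym (*-distribˡ-sum 2 (λ i → 𝟙 (a ∈ᵥ lookup D i ∧ b ∈ᵥ lookup D i)))) ⟩
    length D + 2 * codegree a b
      ∎
    where
    open ≡-Reasoning
    v = (a , b) , a<b

module _ {N k : ℕ} (D : List (KVertex N)) (dominating : ∀ v → k ≤ closedNbhdCount D v) where

  pair-bound< : ∀ {u w} (u<w : u Fin.< w) → k + degree D u + degree D w ≤ length D + 2 * codegree D u w
  pair-bound< {u} {w} u<w = subst (k + degree D u + degree D w ≤_) (closedNbhdCount-degree D u<w)
    (+-monoˡ-≤ _ (+-monoˡ-≤ _ (dominating ((_ , _) , u<w))))

  pair-bound : ∀ {u w} → u ≢ w → k + degree D u + degree D w ≤ length D + 2 * codegree D u w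
  pair-bound {u} {w} u≢w with Data.Fin.Properties.<-cmp u w
  ... | tri< u<w _ _ = pair-bound< u<w
  ... | tri≈ _ u≡w _ = contradiction u≡w u≢w
  ... | tri> _ _ w<u = subst₂ _≤_ (xy∙z≈xz∙y k _ _) (cong (λ c → length D + 2 * c) (codegree-comm D w u))
    (pair-bound< w<u)

k≤length : ∀ {n k} (D : List (KVertex (2 + n))) → (∀ v → k ≤ closedNbhdCount D v) → k ≤ length D
k≤length D dominating = ≤-trans (dominating v) (length-filter (T? ∘ inClosedNbhd v) D)
  where
  v : KVertex _
  v = (zero , suc zero) , s≤s z≤n

-- A point w with c = 0 edges to u has degree x < Δ, because x + Δ ≤ T = 2Δ − 1.
tight-step : ∀ {x Δ T} c → 2 * Δ ≡ suc T → x + Δ ≤ T + 2 * c → x ≤ Δ → x + 1 ≤ Δ + c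
tight-step {x} {Δ} {T} zero 2Δ≡1+T x+Δ≤T _ = +-cancelʳ-≤ Δ _ _ (begin
  x + 1 + Δ    ≡⟨ xy∙z≈xz∙y x 1 Δ ⟩
  x + Δ + 1    ≡⟨ +-comm (x + Δ) 1 ⟩
  suc (x + Δ)  ≤⟨ s≤s x+Δ≤T ⟩
  suc (T + 0)  ≡⟨ cong suc (+-identityʳ T) ⟩
  suc T        ≡⟨ 2Δ≡1+T ⟨
  2 * Δ        ≡⟨ cong (Δ +_) (+-identityʳ Δ) ⟩
  Δ + Δ        ≡⟨ cong (_+ Δ) (+-identityʳ Δ) ⟨
  Δ + 0 + Δ    ∎)
  where open ≤-Reasoning
tight-step {x} {Δ} (suc c) _ _ x≤Δ = begin
  x + 1        ≤⟨ +-monoˡ-≤ 1 x≤Δ ⟩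
  Δ + 1        ≤⟨ +-monoʳ-≤ Δ (s≤s z≤n) ⟩
  Δ + suc c    ∎
  where open ≤-Reasoning

-- pair-bound summed over the points w ≠ u, for u of maximum degree Δ: R is the degree sum over
-- these N' points and T = m − k the excess.
record DegreeBounds (N' k m : ℕ) : Set where
  field
    T Δ R          : ℕ
    excess         : m ≡ k + T
    handshake      : 2 * m ≡ Δ + R
    maximality     : R ≤ N' * Δ
    pair-sum       : R + N' * Δ ≤ N' * T + 2 * Δ
    tight-pair-sum : 2 * Δ ≡ suc T → R + N' ≤ N' * Δ + Δ

module _ {N' k T : ℕ} (D : List (KVertex (suc N'))) (dominating : ∀ v → k ≤ closedNbhdCount D v)
         (excess : length D ≡ k + T) (u : Fin (suc N')) (maximal : ∀ w → degree D w ≤ degree D u) where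

  private
    Δ R : ℕ
    Δ = degree D u
    R = ∑[ j < N' ] degree D (punchIn u j)

  codegree-others : ∑[ j < N' ] codegree D u (punchIn u j) ≡ Δ
  codegree-others = +-cancelˡ-≡ Δ _ _ (begin
    Δ + ∑[ j < N' ] codegree D u (punchIn u j)               ≡⟨ cong (_+ others) (codegree-diag D u) ⟨
    codegree D u u + ∑[ j < N' ] codegree D u (punchIn u j)  ≡⟨ sum-remove {i = u} (codegree D u) ⟨
    ∑[ w < suc N' ] codegree D u w                           ≡⟨ ∑-codegree D u ⟩
    2 * Δ                                                    ≡⟨ cong (Δ +_) (+-identityʳ Δ) ⟩
    Δ + Δ                                                    ∎)
    where
    open ≡-Reasoning
    others = ∑[ j < N' ] codegree D u (punchIn u j)

  pair-bound-at-max : ∀ j → degree D (punchIn u j) + Δ ≤ T + 2 * codegree D u (punchIn u j)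
  pair-bound-at-max j = +-cancelˡ-≤ k _ _ (subst₂ _≤_
    (trans (xy∙z≈xz∙y k Δ (degree D w)) (+-assoc k (degree D w) Δ))
    (trans (cong (_+ 2 * codegree D u w) excess) (+-assoc k T (2 * codegree D u w)))
    (pair-bound D dominating (punchInᵢ≢i u j ∘ sym)))
    where w = punchIn u j

  degreeBounds-at : DegreeBounds N' k (length D)
  degreeBounds-at = record
    { T = T ; Δ = Δ ; R = R
    ; excess = excess
    ; handshake = trans (sym (∑-degree D)) (sum-remove {i = u} (degree D))
    ; maximality = subst (R ≤_) (∑-const N' Δ) (∑-mono-≤ (maximal ∘ punchIn u))
    ; pair-sum = subst₂ _≤_ (∑-+-const (degree D ∘ punchIn u) Δ) pairs-rhs (∑-mono-≤ pair-bound-at-max)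
    ; tight-pair-sum = λ 2Δ≡1+T → subst₂ _≤_
        (trans (∑-+-const (degree D ∘ punchIn u) 1) (cong (R +_) (*-identityʳ N')))
        (trans (∑-const-+ Δ (codegree D u ∘ punchIn u)) (cong (N' * Δ +_) codegree-others))
        (∑-mono-≤ (λ j → tight-step (codegree D u (punchIn u j)) 2Δ≡1+T
          (pair-bound-at-max j) (maximal (punchIn u j))))
    }
    where
    open ≡-Reasoning
    pairs-rhs : ∑[ j < N' ] (T + 2 * codegree D u (punchIn u j)) ≡ N' * T + 2 * Δ
    pairs-rhs = begin
      ∑[ j < N' ] (T + 2 * codegree D u (punchIn u j))
        ≡⟨ ∑-const-+ T (λ j → 2 * codegree D u (punchIn u j)) ⟩
      N' * T + ∑[ j < N' ] (2 * codegree D u (punchIn u j))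
        ≡⟨ cong (N' * T +_) (*-distribˡ-sum 2 (codegree D u ∘ punchIn u)) ⟨
      N' * T + 2 * ∑[ j < N' ] codegree D u (punchIn u j)
        ≡⟨ cong (λ c → N' * T + 2 * c) codegree-others ⟩
      N' * T + 2 * Δ
        ∎

degreeBounds : ∀ {N' k} (D : List (KVertex (suc N'))) → (∀ v → k ≤ closedNbhdCount D v) → k ≤ length D →
  DegreeBounds N' k (length D)
degreeBounds {N'} {k} D dominating k≤m =
  degreeBounds-at {T = length D ∸ k} D dominating (sym (m+[n∸m]≡n k≤m)) (argmax (degree D) zero (allFin (suc N')))
    (λ w → All.lookup (f[xs]≤f[argmax] {f = degree D} zero (allFin (suc N'))) (∈-allFin w))

double-suc : ∀ n → 2 * suc n ≡ suc (2 * n + 1)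
double-suc = solve-∀

-- The cases 2Δ < T + 1, 2Δ = T + 1 (with Δ = d + 1) and 2Δ > T + 1, for n = n' + 4 points.
data DegreeCase (n' k T : ℕ) : Set where
  sparse   : ∀ Δ → 2 * Δ ≤ T → 2 * k ≤ n' * Δ → DegreeCase n' k T
  balanced : ∀ d → T ≡ 2 * d + 1 → 2 * k ≤ suc n' * d → DegreeCase n' k T
  dense    : 4 * k + 2 * n' ≤ (2 + n') * T → DegreeCase n' k T

sparse-bound : ∀ n' k T Δ R → 2 * (k + T) ≡ Δ + R → R ≤ (3 + n') * Δ → 2 * Δ ≤ T → 2 * k ≤ n' * Δ
sparse-bound n' k T Δ R handshake R≤ 2Δ≤T = +-cancelʳ-≤ (2 * (2 * Δ)) _ _ (begin
  2 * k + 2 * (2 * Δ)  ≤⟨ +-monoʳ-≤ (2 * k) (*-monoʳ-≤ 2 2Δ≤T) ⟩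
  2 * k + 2 * T        ≡⟨ *-distribˡ-+ 2 k T ⟨
  2 * (k + T)          ≡⟨ handshake ⟩
  Δ + R                ≤⟨ +-monoʳ-≤ Δ R≤ ⟩
  Δ + (3 + n') * Δ     ≡⟨ e n' Δ ⟩
  n' * Δ + 2 * (2 * Δ) ∎)
  where
  open ≤-Reasoning
  e : ∀ n' Δ → Δ + (3 + n') * Δ ≡ n' * Δ + 2 * (2 * Δ)
  e = solve-∀

balanced-bound : ∀ n' k T d R → 2 * (k + T) ≡ suc d + R → R + (3 + n') ≤ (3 + n') * suc d + suc d →
  T ≡ 2 * d + 1 → 2 * k ≤ suc n' * d
balanced-bound n' k T d R handshake R+N'≤ refl = +-cancelʳ-≤ (4 * d + 5 + n') _ _ (begin
  2 * k + (4 * d + 5 + n')                  ≡⟨ e₁ k d n' ⟩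
  2 * (k + (2 * d + 1)) + (3 + n')          ≡⟨ cong (_+ (3 + n')) handshake ⟩
  suc d + R + (3 + n')                      ≡⟨ +-assoc (suc d) R (3 + n') ⟩
  suc d + (R + (3 + n'))                    ≤⟨ +-monoʳ-≤ (suc d) R+N'≤ ⟩
  suc d + ((3 + n') * suc d + suc d)        ≡⟨ e₂ d n' ⟩
  suc n' * d + (4 * d + 5 + n')             ∎)
  where
  open ≤-Reasoning
  e₁ : ∀ k d n' → 2 * k + (4 * d + 5 + n') ≡ 2 * (k + (2 * d + 1)) + (3 + n')
  e₁ = solve-∀
  e₂ : ∀ d n' → suc d + ((3 + n') * suc d + suc d) ≡ suc n' * d + (4 * d + 5 + n')
  e₂ = solve-∀

dense-bound : ∀ n' k T Δ R → 2 * (k + T) ≡ Δ + R → R + (3 + n') * Δ ≤ (3 + n') * T + 2 * Δ →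
  suc (suc T) ≤ 2 * Δ → 4 * k + 2 * n' ≤ (2 + n') * T
dense-bound n' k T Δ R handshake pairs 2+T≤2Δ = +-cancelʳ-≤ (n' * T) _ _ (begin
  4 * k + 2 * n' + n' * T        ≡⟨ e₁ k n' T ⟩
  2 * (2 * k) + n' * (2 + T)     ≤⟨ +-monoʳ-≤ (2 * (2 * k)) (*-monoʳ-≤ n' 2+T≤2Δ) ⟩
  2 * (2 * k) + n' * (2 * Δ)     ≡⟨ e₂ k n' Δ ⟩
  2 * (2 * k + n' * Δ)           ≤⟨ *-monoʳ-≤ 2 halved ⟩
  2 * (suc n' * T)               ≡⟨ e₃ n' T ⟩
  (2 + n') * T + n' * T          ∎)
  where
  open ≤-Reasoning
  e₁ : ∀ k n' T → 4 * k + 2 * n' + n' * T ≡ 2 * (2 * k) + n' * (2 + T)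
  e₁ = solve-∀
  e₂ : ∀ k n' Δ → 2 * (2 * k) + n' * (2 * Δ) ≡ 2 * (2 * k + n' * Δ)
  e₂ = solve-∀
  e₃ : ∀ n' T → 2 * (suc n' * T) ≡ (2 + n') * T + n' * T
  e₃ = solve-∀
  halved : 2 * k + n' * Δ ≤ suc n' * T
  halved = +-cancelʳ-≤ (2 * T + 3 * Δ) _ _ (begin
    2 * k + n' * Δ + (2 * T + 3 * Δ)  ≡⟨ e₄ k T Δ n' ⟩
    2 * (k + T) + (3 + n') * Δ        ≡⟨ cong (_+ (3 + n') * Δ) handshake ⟩
    Δ + R + (3 + n') * Δ              ≡⟨ +-assoc Δ R _ ⟩
    Δ + (R + (3 + n') * Δ)            ≤⟨ +-monoʳ-≤ Δ pairs ⟩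
    Δ + ((3 + n') * T + 2 * Δ)        ≡⟨ e₅ T Δ n' ⟩
    suc n' * T + (2 * T + 3 * Δ)      ∎)
    where
    e₄ : ∀ k T Δ n' → 2 * k + n' * Δ + (2 * T + 3 * Δ) ≡ 2 * (k + T) + (3 + n') * Δ
    e₄ = solve-∀
    e₅ : ∀ T Δ n' → Δ + ((3 + n') * T + 2 * Δ) ≡ suc n' * T + (2 * T + 3 * Δ)
    e₅ = solve-∀

balanced-case : ∀ n' k T R Δ → 2 * (k + T) ≡ Δ + R → (2 * Δ ≡ suc T → R + (3 + n') ≤ (3 + n') * Δ + Δ) →
  2 * Δ ≡ suc T → DegreeCase n' k T
balanced-case n' k T R (suc d) handshake tight 2Δ≡1+T =
  balanced d T≡2d+1 (balanced-bound n' k T d R handshake (tight 2Δ≡1+T) T≡2d+1)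
  where
  T≡2d+1 : T ≡ 2 * d + 1
  T≡2d+1 = suc-injective (trans (sym 2Δ≡1+T) (double-suc d))

degreeCase : ∀ {n' k m} (B : DegreeBounds (3 + n') k m) → DegreeCase n' k (DegreeBounds.T B)
degreeCase {n'} {k} B = classify (<-cmp (2 * Δ) (suc T))
  where
  open DegreeBounds B
  handshake′ : 2 * (k + T) ≡ Δ + R
  handshake′ = trans (cong (2 *_) (sym excess)) handshake
  classify : Tri (2 * Δ < suc T) (2 * Δ ≡ suc T) (suc T < 2 * Δ) → DegreeCase n' k T
  classify (tri< 2Δ<1+T _ _) = sparse Δ (≤-pred 2Δ<1+T) (sparse-bound n' k T Δ R handshake′ maximality (≤-pred 2Δ<1+T))
  classify (tri≈ _ 2Δ≡1+T _) = balanced-case n' k T R Δ handshake′ tight-pair-sum 2Δ≡1+T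
  classify (tri> _ _ 1+T<2Δ) = dense (dense-bound n' k T Δ R handshake′ pair-sum 1+T<2Δ)

double-< : ∀ {x} k c → x < 2 * k → 2 * suc x + c ≤ 4 * k + c
double-< {x} k c x<2k = +-monoˡ-≤ c (≤-trans (*-monoʳ-≤ 2 x<2k) (≤-reflexive (e k)))
  where
  e : ∀ k → 2 * (2 * k) ≡ 4 * k
  e = solve-∀

half-≤ : ∀ {x b} → 2 * x ≤ 2 * b + 1 → x ≤ b
half-≤ {x} {b} 2x≤2b+1 = ≤-pred (*-cancelˡ-< 2 x (suc b) (subst (suc (2 * x) ≤_) (sym (double-suc b)) (s≤s 2x≤2b+1)))

2α≤excess : ∀ {b n' k T} → b * suc n' < 2 * k → 2 * b + 1 ≤ n' → DegreeCase n' k T → 2 * suc b ≤ T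
2α≤excess {b} {n'} {k} {T} lower n'-large case =
  ≮⇒≥ (λ T<2α → impossible (≤-pred (subst (T <_) (double-suc b) T<2α)) case)
  where
  open ≤-Reasoning
  impossible : T ≤ 2 * b + 1 → DegreeCase n' k T → ⊥
  impossible T≤2b+1 (sparse Δ 2Δ≤T 2k≤n'Δ) = <⇒≱ lower (begin
    2 * k        ≤⟨ 2k≤n'Δ ⟩
    n' * Δ       ≤⟨ *-monoʳ-≤ n' (half-≤ (≤-trans 2Δ≤T T≤2b+1)) ⟩
    n' * b       ≤⟨ m≤n+m (n' * b) b ⟩
    b + n' * b   ≡⟨ *-comm (suc n') b ⟩
    b * suc n'   ∎)
  impossible T≤2b+1 (balanced d refl 2k≤) = <⇒≱ lower (begin
    2 * k        ≤⟨ 2k≤ ⟩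
    suc n' * d   ≤⟨ *-monoʳ-≤ (suc n') (half-≤ (≤-trans (m≤m+n (2 * d) 1) T≤2b+1)) ⟩
    suc n' * b   ≡⟨ *-comm (suc n') b ⟩
    b * suc n'   ∎)
  impossible T≤2b+1 (dense 4k+2n'≤) = <⇒≱ (subst (_≤ n') (+-comm (2 * b) 1) n'-large)
    (+-cancelˡ-≤ (2 * suc (b * suc n') + n') n' (2 * b) (begin
    2 * suc (b * suc n') + n' + n'     ≡⟨ e₁ (b * suc n') n' ⟩
    2 * suc (b * suc n') + 2 * n'      ≤⟨ double-< k (2 * n') lower ⟩
    4 * k + 2 * n'                     ≤⟨ 4k+2n'≤ ⟩
    (2 + n') * T                       ≤⟨ *-monoʳ-≤ (2 + n') T≤2b+1 ⟩
    (2 + n') * (2 * b + 1)             ≡⟨ e₃ b n' ⟩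
    2 * suc (b * suc n') + n' + 2 * b  ∎))
    where
    e₁ : ∀ x n' → 2 * suc x + n' + n' ≡ 2 * suc x + 2 * n'
    e₁ = solve-∀
    e₃ : ∀ b n' → (2 + n') * (2 * b + 1) ≡ 2 * suc (b * suc n') + n' + 2 * b
    e₃ = solve-∀

2k≢[2b+1]α+1 : ∀ b k → suc b % 2 ≡ 0 → 2 * k ≢ suc ((2 * b + 1) * suc b)
2k≢[2b+1]α+1 b k even 2k≡ = even≢odd k ((2 * b + 1) * h) (begin
  2 * k                          ≡⟨ 2k≡ ⟩
  suc ((2 * b + 1) * suc b)      ≡⟨ cong (λ α → suc ((2 * b + 1) * α)) α≡h*2 ⟩
  suc ((2 * b + 1) * (h * 2))    ≡⟨ cong suc (e (2 * b + 1) h) ⟩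
  suc (2 * ((2 * b + 1) * h))    ∎)
  where
  open ≡-Reasoning
  h = suc b / 2
  α≡h*2 : suc b ≡ h * 2
  α≡h*2 = trans (m≡m%n+[m/n]*n (suc b) 2) (cong (_+ h * 2) even)
  e : ∀ x h → x * (h * 2) ≡ 2 * (x * h)
  e = solve-∀

dense⇒n'≤2b+1 : ∀ b n' k {T} → n' * suc b < 2 * k → T ≤ 2 * suc b → 4 * k + 2 * n' ≤ (2 + n') * T →
  n' ≤ 2 * b + 1
dense⇒n'≤2b+1 b n' k {T} lower T≤2α 4k+2n'≤ =
  ≤-pred (subst (suc n' ≤_) (double-suc b) (*-cancelˡ-≤ 2 (+-cancelˡ-≤ (2 * (n' * suc b)) _ _ (begin
    2 * (n' * suc b) + 2 * suc n'       ≡⟨ e₁ (n' * suc b) n' ⟩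
    2 * suc (n' * suc b) + 2 * n'       ≤⟨ double-< k (2 * n') lower ⟩
    4 * k + 2 * n'                      ≤⟨ 4k+2n'≤ ⟩
    (2 + n') * T                        ≤⟨ *-monoʳ-≤ (2 + n') T≤2α ⟩
    (2 + n') * (2 * suc b)              ≡⟨ e₂ n' (suc b) ⟩
    2 * (n' * suc b) + 2 * (2 * suc b)  ∎))))
  where
  open ≤-Reasoning
  e₁ : ∀ x n' → 2 * x + 2 * suc n' ≡ 2 * suc x + 2 * n'
  e₁ = solve-∀
  e₂ : ∀ n' α → (2 + n') * (2 * α) ≡ 2 * (n' * α) + 2 * (2 * α)
  e₂ = solve-∀

dense-upper : ∀ b k {T} → T ≤ 2 * suc b → 4 * k + 2 * (2 * b + 1) ≤ (2 + (2 * b + 1)) * T →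
  2 * k ≤ suc ((2 * b + 1) * suc b)
dense-upper b k {T} T≤2α 4k+2n'≤ = *-cancelˡ-≤ 2 (+-cancelʳ-≤ (2 * (2 * b + 1)) _ _ (begin
  2 * (2 * k) + 2 * (2 * b + 1)                    ≡⟨ cong (_+ 2 * (2 * b + 1)) (e₁ k) ⟩
  4 * k + 2 * (2 * b + 1)                          ≤⟨ 4k+2n'≤ ⟩
  (2 + (2 * b + 1)) * T                            ≤⟨ *-monoʳ-≤ (2 + (2 * b + 1)) T≤2α ⟩
  (2 + (2 * b + 1)) * (2 * suc b)                  ≡⟨ e₂ b ⟩
  2 * suc ((2 * b + 1) * suc b) + 2 * (2 * b + 1)  ∎))
  where
  open ≤-Reasoning
  e₁ : ∀ k → 2 * (2 * k) ≡ 4 * k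
  e₁ = solve-∀
  e₂ : ∀ b → (2 + (2 * b + 1)) * (2 * suc b) ≡ 2 * suc ((2 * b + 1) * suc b) + 2 * (2 * b + 1)
  e₂ = solve-∀

2α+1≤excess : ∀ {b n' k T} → n' * suc b < 2 * k → 2 * b + 1 + suc b % 2 ≤ n' → DegreeCase n' k T → 2 * suc b + 1 ≤ T
2α+1≤excess {b} {n'} {k} {T} lower n'-large case =
  ≮⇒≥ (λ T<2α+1 → impossible (≤-pred (subst (T <_) (+-comm (2 * suc b) 1) T<2α+1)) case)
  where
  open ≤-Reasoning
  b≤n' : b ≤ n'
  b≤n' = ≤-trans (≤-trans (m≤m+n b (b + 0)) (m≤m+n (2 * b) _)) (≤-trans (m≤m+n (2 * b + 1) _) n'-large)
  impossible : T ≤ 2 * suc b → DegreeCase n' k T → ⊥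
  impossible T≤2α (sparse Δ 2Δ≤T 2k≤n'Δ) = <⇒≱ lower (begin
    2 * k        ≤⟨ 2k≤n'Δ ⟩
    n' * Δ       ≤⟨ *-monoʳ-≤ n' (*-cancelˡ-≤ 2 (≤-trans 2Δ≤T T≤2α)) ⟩
    n' * suc b   ∎)
  impossible T≤2α (balanced d refl 2k≤) = <⇒≱ lower (begin
    2 * k        ≤⟨ 2k≤ ⟩
    suc n' * d   ≤⟨ *-monoʳ-≤ (suc n') (half-≤ (≤-pred (subst₂ _≤_ (+-comm (2 * d) 1) (double-suc b) T≤2α))) ⟩
    b + n' * b   ≤⟨ +-monoˡ-≤ (n' * b) b≤n' ⟩
    n' + n' * b  ≡⟨ *-suc n' b ⟨
    n' * suc b   ∎)
  impossible T≤2α (dense 4k+2n'≤) = 2k≢[2b+1]α+1 b k α-even (≤-antisym (dense-upper b k T≤2α dense′) lower′)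
    where
    n'≡2b+1 : n' ≡ 2 * b + 1
    n'≡2b+1 = ≤-antisym (dense⇒n'≤2b+1 b n' k lower T≤2α 4k+2n'≤) (≤-trans (m≤m+n (2 * b + 1) _) n'-large)
    α-even : suc b % 2 ≡ 0
    α-even = n≤0⇒n≡0 (+-cancelˡ-≤ (2 * b + 1) _ 0
      (subst (2 * b + 1 + suc b % 2 ≤_) (trans n'≡2b+1 (sym (+-identityʳ (2 * b + 1)))) n'-large))
    lower′ : suc ((2 * b + 1) * suc b) ≤ 2 * k
    lower′ = subst (λ n' → n' * suc b < 2 * k) n'≡2b+1 lower
    dense′ : 4 * k + 2 * (2 * b + 1) ≤ (2 + (2 * b + 1)) * T
    dense′ = subst (λ n' → 4 * k + 2 * n' ≤ (2 + n') * T) n'≡2b+1 4k+2n'≤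

⌈m/n⌉≡1+q⇒q*n<m : ∀ {m b q} → ⌈ m / suc b ⌉ ≡ suc q → q * suc b < m
⌈m/n⌉≡1+q⇒q*n<m {m} {b} {q} ⌈m/n⌉≡1+q = +-cancelˡ-≤ b _ _ (begin
  b + suc (q * suc b)      ≡⟨ +-suc b (q * suc b) ⟩
  suc q * suc b            ≡⟨ cong (_* suc b) ⌈m/n⌉≡1+q ⟨
  (m + b) / suc b * suc b  ≤⟨ m/n*n≤m (m + b) (suc b) ⟩
  m + b                    ≡⟨ +-comm m b ⟩
  b + m                    ∎)
  where open ≤-Reasoning

≤-peel : ∀ m {x n} → m + x ≤ n → ∃[ n' ] (n ≡ m + n' × x ≤ n')
≤-peel zero    x≤n       = _ , refl , x≤n
≤-peel (suc m) (s≤s m+x≤n) with ≤-peel m m+x≤n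
... | n' , refl , x≤n' = n' , refl , x≤n'

γ×≥-from-excess : ∀ {n' k c} → (∀ {T} → DegreeCase n' k T → c ≤ T) → γ×≥ k (4 + n') (k + c)
γ×≥-from-excess {k = k} {c} excess≥c D (_ , dominating) =
  subst (k + c ≤_) (sym excess) (+-monoʳ-≤ k (excess≥c (degreeCase B)))
  where
  B = degreeBounds D dominating (k≤length D dominating)
  open DegreeBounds B

proposition21 : (α n k : ℕ) → 2 ≤ α → 2 * α + 3 + (α % 2) ≤ n → 1 ≤ k →
    ((2 * k + 4 * α ≤ α * n) → ((α ∸ 1) * (n ∸ 3) < 2 * k) → γ×≥ k n (k + 2 * α))
    × (n ≡ ⌈ 2 * k / α ⌉ + 3 → γ×≥ k n (k + 2 * α + 1))
proposition21 zero    _ _ () _ _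
proposition21 (suc b) n k _ n-large _ with ≤-peel 4 (subst (_≤ n) (shape b (suc b % 2)) n-large)
  where
  shape : ∀ b r → 2 * suc b + 3 + r ≡ 4 + (2 * b + 1 + r)
  shape = solve-∀
... | n' , refl , n'-large = (λ _ → bound₁) , bound₂
  where
  bound₁ : b * suc n' < 2 * k → γ×≥ k (4 + n') (k + 2 * suc b)
  bound₁ lower = γ×≥-from-excess (2α≤excess lower (≤-trans (m≤m+n (2 * b + 1) (suc b % 2)) n'-large))
  bound₂ : 4 + n' ≡ ⌈ 2 * k / suc b ⌉ + 3 → γ×≥ k (4 + n') (k + 2 * suc b + 1)
  bound₂ n≡⌈2k/α⌉+3 = subst (γ×≥ k (4 + n')) (sym (+-assoc k (2 * suc b) 1))
    (γ×≥-from-excess (2α+1≤excess (⌈m/n⌉≡1+q⇒q*n<m ⌈2k/α⌉≡1+n') n'-large))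
    where
    ⌈2k/α⌉≡1+n' : ⌈ 2 * k / suc b ⌉ ≡ suc n'
    ⌈2k/α⌉≡1+n' = +-cancelʳ-≡ 3 _ (suc n') (trans (sym n≡⌈2k/α⌉+3) (+-comm 3 (suc n')))
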